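{- Let $G$ be a graph satisfying the pairwise edge-disjoint path property. Then for any commutative ring $R$ with unity and any edge-labeling $\alpha$ of $G$ over $R$, $(G,\alpha)$ satisfies the Universal Difference Property.
   Context: Graphs are connected. A path has no repeated vertices. $G$ has the pairwise edge-disjoint path property if for any distinct vertices $u,v$ and any two distinct $u,v$-paths $P_1,P_2$, $E(P_1)\cap E(P_2)=\emptyset$. An edge-labeling assigns to each edge an ideal of $R$. A spline on $(G,\alpha)$ is a function $\rho:V(G)\to R$ with $\rho(u)-\rho(v)\in\alpha(uv)$ for every edge $uv$. For a path $P$, $\alpha(P)$ is the sum of the labels of its edges. $(G,\alpha)$ satisfies the Universal Difference Property if for every pair of vertices $u,w$ and every $x\in\bigcap_P\alpha(P)$ (over all paths $P$ from $u$ to $w$) there is a spline $\rho$ with $\rho(u)-\rho(w)=x$. -}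

module Defs where

open import Level using (Level; _⊔_; suc; Lift)
open import Data.Nat using (ℕ)
open import Data.Fin using (Fin)
open import Data.Bool using (Bool; true; false)
open import Data.List using (List; []; _∷_)
open import Data.List.Relation.Unary.Unique.Propositional using (Unique)
open import Data.Product using (Σ; _×_; ∃; ∃-syntax; _,_)
open import Data.Sum using (_⊎_)
open import Relation.Nullary using (¬_)
open import Relation.Binary.PropositionalEquality using (_≡_; _≢_)
open import Algebra.Bundles using (CommutativeRing)

record Graph : Set where
  field
    n     : ℕ
    adj   : Fin n → Fin n → Bool
    sym   : ∀ u v → adj u v ≡ adj v u
    irrefl : ∀ u → adj u u ≡ false

module _ (G : Graph) where
  open Graph G

  Edge : Fin n → Fin n → Set
  Edge u v = adj u v ≡ true

  Walk : List (Fin n) → Set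
  Walk [] = Data.Unit.⊤ where import Data.Unit
  Walk (a ∷ []) = Data.Unit.⊤ where import Data.Unit
  Walk (a ∷ b ∷ rest) = Edge a b × Walk (b ∷ rest)

  StartsAt : List (Fin n) → Fin n → Set
  StartsAt [] u = Data.Empty.⊥ where import Data.Empty
  StartsAt (a ∷ _) u = a ≡ u

  EndsAt : List (Fin n) → Fin n → Set
  EndsAt [] w = Data.Empty.⊥ where import Data.Empty
  EndsAt (a ∷ []) w = a ≡ w
  EndsAt (a ∷ b ∷ rest) w = EndsAt (b ∷ rest) w

  IsPath : Fin n → Fin n → List (Fin n) → Set
  IsPath u w P = StartsAt P u × EndsAt P w × Walk P × Unique P

  Consecutive : List (Fin n) → Fin n → Fin n → Set
  Consecutive [] a b = Data.Empty.⊥ where import Data.Empty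
  Consecutive (x ∷ []) a b = Data.Empty.⊥ where import Data.Empty
  Consecutive (x ∷ y ∷ rest) a b = (x ≡ a × y ≡ b) ⊎ Consecutive (y ∷ rest) a b

  EdgeIn : List (Fin n) → Fin n → Fin n → Set
  EdgeIn P a b = Consecutive P a b ⊎ Consecutive P b a

  Connected : Set
  Connected = ∀ u w → ∃[ P ] IsPath u w P

  PEDPP : Set
  PEDPP = ∀ u v → u ≢ v → ∀ P₁ P₂ → IsPath u v P₁ → IsPath u v P₂ → P₁ ≢ P₂ →
            ∀ a b → ¬ (EdgeIn P₁ a b × EdgeIn P₂ a b)

record Ideal {c ℓ} (R : CommutativeRing c ℓ) (ℓ' : Level) : Set (c ⊔ ℓ ⊔ suc ℓ') where
  open CommutativeRing R
  field
    _∈I     : Carrier → Set ℓ'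
    resp    : ∀ {x y} → x ≈ y → x ∈I → y ∈I
    0∈      : 0# ∈I
    +-closed : ∀ {x y} → x ∈I → y ∈I → (x + y) ∈I
    neg-closed : ∀ {x} → x ∈I → (- x) ∈I
    *-closed : ∀ r {x} → x ∈I → (r * x) ∈I

module _ {c ℓ} (R : CommutativeRing c ℓ) (G : Graph) (ℓ' : Level) where
  open Graph G
  open CommutativeRing R

  -- an edge-labeling: assigns an ideal to each (unordered) edge,
  -- represented by a symmetric function on ordered pairs of vertices
  record EdgeLabeling : Set (c ⊔ ℓ ⊔ suc ℓ') where
    field
      label : Fin n → Fin n → Ideal R ℓ'
      label-sym : ∀ u v → label u v ≡ label v u

  module _ (α : EdgeLabeling) where
    open EdgeLabeling α


    -- membership in α(P) = sum of the labels of the edges of P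
    -- (the empty sum, for a one-vertex path, is the zero ideal)
    InPathIdeal : List (Fin n) → Carrier → Set (c ⊔ ℓ ⊔ ℓ')
    InPathIdeal [] x = Lift (c ⊔ ℓ') (x ≈ 0#)
    InPathIdeal (a ∷ []) x = Lift (c ⊔ ℓ') (x ≈ 0#)
    InPathIdeal (a ∷ b ∷ rest) x =
      Σ Carrier λ y → Σ Carrier λ z →
        Ideal._∈I (label a b) y × InPathIdeal (b ∷ rest) z × x ≈ y + z

    IsSpline : (Fin n → Carrier) → Set ℓ'
    IsSpline ρ = ∀ u v → Edge G u v → Ideal._∈I (label u v) (ρ u - ρ v)

    UniversalDifferenceProperty : Set (c ⊔ ℓ ⊔ ℓ')
    UniversalDifferenceProperty =
      ∀ u w (x : Carrier) →
        (∀ P → IsPath G u w P → InPathIdeal P x) →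
        Σ (Fin n → Carrier) λ ρ → IsSpline ρ × (ρ u - ρ w) ≈ x

-- In a graph with the pairwise edge-disjoint path property, two distinct u–w paths meet only in u
-- and w. Split x along each u–w path into summands from the labels of its edges; the partial sums
-- give values on the vertices of the path which agree wherever two paths meet (x at u, 0 at w).
-- A vertex on no u–w path takes the value of the first vertex on a u–w path along a fixed path to w.
-- An edge between two vertices on u–w paths can be spliced into a u–w path, so the difference across
-- it is one of the summands. If an end of an edge lies on no u–w path, both ends reach the same first
-- vertex: a detour through the edge between two distinct ones would splice into a u–w path.

{-# OPTIONS --safe #-}
module Submission where

open import Defs
open import Level using (Level; lower)
open import Algebra.Bundles using (CommutativeRing)
open import Data.Bool using (true; if_then_else_)
import Data.Bool.Properties as Bool
open import Data.Nat using (ℕ; zero; suc; _≤_; s≤s)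
open import Data.Nat.Properties using (_≤?_; ≰⇒>)
open import Data.Fin using (Fin; zero; suc; _≟_)
import Data.Fin as Fin
open import Data.Fin.Properties using (pigeonhole)
open import Data.List using (List; []; _∷_; _++_; reverse; length; lookup; allFin; cartesianProductWith)
open import Data.List.Properties using (++-assoc; unfold-reverse; ≡-dec)
open import Data.List.Relation.Unary.All as All using (All; []; _∷_)
import Data.List.Relation.Unary.All.Properties as All
import Data.List.Relation.Unary.AllPairs as AllPairs
open import Data.List.Relation.Unary.AllPairs using ([]; _∷_)
open import Data.List.Relation.Unary.Any using (here; there; satisfied; any?)
import Data.List.Relation.Unary.Any.Properties as Any
open import Data.List.Relation.Unary.Unique.Propositional using (Unique)
import Data.List.Relation.Unary.Unique.Propositional.Properties as Unique
import Data.List.Relation.Unary.Unique.DecPropositional as DecUnique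
open import Data.List.Relation.Binary.Disjoint.Propositional using (Disjoint)
open import Data.List.Relation.Binary.Subset.Propositional using (_⊆_)
open import Data.List.Membership.Propositional using (_∈_; _∉_; lose)
open import Data.List.Membership.Propositional.Properties
  using (∈-++⁺ˡ; ∈-++⁺ʳ; ∈-++⁻; ∈-∃++; ∈-lookup; ∈-allFin; ∈-cartesianProductWith⁺)
import Data.List.Membership.DecPropositional as DecMembership
open import Data.Product using (∃; ∃₂; _×_; _,_; proj₁; proj₂)
open import Data.Sum using (_⊎_; inj₁; inj₂; swap)
open import Data.Unit using (tt)
open import Data.Empty using (⊥; ⊥-elim)
open import Function using (_∘_)
open import Relation.Nullary using (¬_; Dec; yes; no; does)
open import Relation.Nullary.Decidable using (_×-dec_; map′)
open import Relation.Unary using (Decidable)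
open import Relation.Binary.Definitions using (DecidableEquality)
open import Relation.Binary.PropositionalEquality using (_≡_; _≢_; refl; sym; trans; cong; subst)

module _ {A : Set} where

  private variable
    x y : A
    xs : List A

  Unique-∷⁺ : x ∉ xs → Unique xs → Unique (x ∷ xs)
  Unique-∷⁺ {xs = xs} x∉xs xs! = All.tabulate (λ y∈xs x≡y → x∉xs (subst (_∈ xs) (sym x≡y) y∈xs)) ∷ xs!

  Unique-++⁻ : ∀ xs {ys : List A} → Unique (xs ++ ys) → Unique xs × Unique ys × Disjoint xs ys
  Unique-++⁻ [] ys! = [] , ys! , λ { (() , _) }
  Unique-++⁻ (x ∷ xs) (x∉ ∷ xs++ys!) with Unique-++⁻ xs xs++ys!
  ... | xs! , ys! , xs#ys = All.++⁻ˡ xs x∉ ∷ xs! , ys! , λ where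
    (here refl , v∈ys) → All.lookup (All.++⁻ʳ xs x∉) v∈ys refl
    (there v∈xs , v∈ys) → xs#ys (v∈xs , v∈ys)

  Unique-reverse⁺ : Unique xs → Unique (reverse xs)
  Unique-reverse⁺ [] = []
  Unique-reverse⁺ {x ∷ xs} (x∉xs ∷ xs!) rewrite unfold-reverse x xs =
    Unique.++⁺ (Unique-reverse⁺ xs!) ([] ∷ [])
      λ { (v∈rev , here refl) → All.lookup x∉xs (Any.reverse⁻ v∈rev) refl }

  Unique-lookup≢ : Unique xs → ∀ {i j} → i Fin.< j → lookup xs i ≢ lookup xs j
  Unique-lookup≢ (x∉ ∷ _) {zero} {suc j} _ = All.lookup x∉ (∈-lookup j)
  Unique-lookup≢ (_ ∷ xs!) {suc i} {suc j} (s≤s i<j) = Unique-lookup≢ xs! i<j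

  Precedes : A → A → List A → Set
  Precedes x y xs = ∃₂ λ as ms → ∃ λ bs → xs ≡ as ++ x ∷ ms ++ y ∷ bs

  ∈-∈-order : ∀ xs → x ∈ xs → y ∈ xs → x ≢ y → Precedes x y xs ⊎ Precedes y x xs
  ∈-∈-order _ x∈ y∈ x≢y with ∈-∃++ x∈
  ... | as , bs , refl with ∈-++⁻ as y∈
  ...   | inj₂ (here y≡x) = ⊥-elim (x≢y (sym y≡x))
  ...   | inj₂ (there y∈bs) with ∈-∃++ y∈bs
  ...     | ms , cs , refl = inj₁ (as , ms , cs , refl)
  ∈-∈-order _ x∈ y∈ x≢y | as , bs , refl | inj₁ y∈as with ∈-∃++ y∈as
  ...     | as′ , ms , refl = inj₂ (as′ , ms , bs , ++-assoc as′ (_ ∷ ms) (_ ∷ bs))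

module _ {n : ℕ} where

  listsUpTo : ℕ → List (List (Fin n))
  listsUpTo zero = [] ∷ []
  listsUpTo (suc k) = [] ∷ cartesianProductWith _∷_ (allFin n) (listsUpTo k)

  ∈-listsUpTo : ∀ k xs → length xs ≤ k → xs ∈ listsUpTo k
  ∈-listsUpTo zero [] _ = here refl
  ∈-listsUpTo (suc k) [] _ = here refl
  ∈-listsUpTo (suc k) (x ∷ xs) (s≤s |xs|≤k) =
    there (∈-cartesianProductWith⁺ _∷_ (∈-allFin x) (∈-listsUpTo k xs |xs|≤k))

  Unique⇒length≤n : ∀ {xs : List (Fin n)} → Unique xs → length xs ≤ n
  Unique⇒length≤n {xs} xs! with length xs ≤? n
  ... | yes |xs|≤n = |xs|≤n
  ... | no |xs|≰n with pigeonhole (≰⇒> |xs|≰n) (lookup xs)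
  ...   | i , j , i<j , xsᵢ≡xsⱼ = ⊥-elim (Unique-lookup≢ xs! i<j xsᵢ≡xsⱼ)

infixr 5 _◅_

data Chain {A : Set} (E : A → A → Set) : A → A → List A → Set where
  end : ∀ {x} → Chain E x x (x ∷ [])
  _◅_ : ∀ {x y z ys} → E x y → Chain E y z ys → Chain E x z (x ∷ ys)

module _ {A : Set} {E : A → A → Set} where

  private variable
    x y z v : A
    xs ys : List A

  Chain-map : ∀ {E′ : A → A → Set} → (∀ {p q} → E p q → E′ p q) → Chain E x y xs → Chain E′ x y xs
  Chain-map f end = end
  Chain-map f (e ◅ c) = f e ◅ Chain-map f c

  Chain-++ : Chain E x y xs → Chain E y z (y ∷ ys) → Chain E x z (xs ++ ys)
  Chain-++ end c′ = c′
  Chain-++ (e ◅ c) c′ = e ◅ Chain-++ c c′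

  Chain-split : ∀ as {bs} → Chain E x y (as ++ v ∷ bs) → Chain E x v (as ++ v ∷ []) × Chain E v y (v ∷ bs)
  Chain-split [] end = end , end
  Chain-split [] (e ◅ c) = end , e ◅ c
  Chain-split (_ ∷ []) (e ◅ c) with Chain-split [] c
  ... | c₁ , c₂ = e ◅ c₁ , c₂
  Chain-split (_ ∷ a ∷ as) (e ◅ c) with Chain-split (a ∷ as) c
  ... | c₁ , c₂ = e ◅ c₁ , c₂

  Chain-reverse : (∀ {p q} → E p q → E q p) → Chain E x y xs → Chain E y x (reverse xs)
  Chain-reverse E-sym end = end
  Chain-reverse {xs = x ∷ xs} E-sym (e ◅ c) rewrite unfold-reverse x xs =
    Chain-++ (Chain-reverse E-sym c) (E-sym e ◅ end)

  Chain-head : Chain E x y xs → ∃ λ ys → xs ≡ x ∷ ys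
  Chain-head end = _ , refl
  Chain-head (_ ◅ _) = _ , refl

  Chain-last∈ : Chain E x y xs → y ∈ xs
  Chain-last∈ end = here refl
  Chain-last∈ (_ ◅ c) = there (Chain-last∈ c)

  Chain-head∈ : Chain E x y xs → x ∈ xs
  Chain-head∈ end = here refl
  Chain-head∈ (_ ◅ _) = here refl

  Chain-head∈-prefix : ∀ as {bs} → Chain E x y (as ++ v ∷ bs) → v ≢ x → x ∈ as
  Chain-head∈-prefix [] c v≢x with Chain-head c
  ... | _ , refl = ⊥-elim (v≢x refl)
  Chain-head∈-prefix (_ ∷ _) c v≢x with Chain-head c
  ... | _ , refl = here refl

  Chain-last∈-suffix : ∀ as {bs} → Chain E x y (as ++ v ∷ bs) → v ≢ y → y ∈ bs
  Chain-last∈-suffix as c v≢y with Chain-last∈ (proj₂ (Chain-split as c))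
  ... | here y≡v = ⊥-elim (v≢y (sym y≡v))
  ... | there y∈bs = y∈bs

  Chain-shorten : DecidableEquality A → Chain E x y xs → ∃ λ ys → Chain E x y ys × Unique ys × ys ⊆ xs
  Chain-shorten _≟_ end = _ , end , [] ∷ [] , λ v∈ → v∈
  Chain-shorten _≟_ (_◅_ {x} e c) with Chain-shorten _≟_ c
  ... | ys , c′ , ys! , ys⊆ with DecMembership._∈?_ _≟_ x ys
  ...   | no x∉ys = x ∷ ys , e ◅ c′ , Unique-∷⁺ x∉ys ys! , λ where
    (here refl) → here refl
    (there v∈ys) → there (ys⊆ v∈ys)
  ...   | yes x∈ys with ∈-∃++ x∈ys
  ...     | as , bs , refl =
    x ∷ bs , proj₂ (Chain-split as c′) , proj₁ (proj₂ (Unique-++⁻ as ys!)) , λ where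
    (here refl) → here refl
    (there v∈bs) → there (ys⊆ (∈-++⁺ʳ as (there v∈bs)))

record FirstHit {A : Set} (E : A → A → Set) (P : A → Set) (x : A) : Set where
  constructor firstHit
  field
    {prefix} : List A
    target   : A
    target-P : P target
    prefix-¬P : All (¬_ ∘ P) prefix
    chain    : Chain E x target (prefix ++ target ∷ [])

  vertices : List A
  vertices = prefix ++ target ∷ []

module _ {A : Set} {E : A → A → Set} {P : A → Set} where

  private variable
    x y c : A
    xs : List A

  Chain-firstHit : Decidable P → Chain E x y xs → P y → FirstHit E P x
  Chain-firstHit {x = x} P? end Py = firstHit x Py [] end
  Chain-firstHit {x = x} P? (e ◅ c) Py with P? x
  ... | yes Px = firstHit x Px [] end
  ... | no ¬Px with Chain-firstHit P? c Py
  ...   | firstHit z Pz ¬P c′ = firstHit z Pz (¬Px ∷ ¬P) (e ◅ c′)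

  FirstHit-self : (h : FirstHit E P x) → P x → FirstHit.target h ≡ x
  FirstHit-self (firstHit _ _ [] end) _ = refl
  FirstHit-self (firstHit _ _ (¬Pp ∷ _) c) Px with Chain-head c
  ... | _ , refl = ⊥-elim (¬Pp Px)

  FirstHit-unique : (h : FirstHit E P x) → c ∈ FirstHit.vertices h → P c → c ≡ FirstHit.target h
  FirstHit-unique (firstHit {prefix} _ _ ¬P _) c∈ Pc with ∈-++⁻ prefix c∈
  ... | inj₁ c∈prefix = ⊥-elim (All.lookup ¬P c∈prefix Pc)
  ... | inj₂ (here c≡z) = c≡z

  FirstHit-chain¬P : (h : FirstHit E P x) → Chain (λ p q → E p q × ¬ P p) x (FirstHit.target h) (FirstHit.vertices h)
  FirstHit-chain¬P (firstHit _ _ ¬P c) = go ¬P c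
    where
    go : ∀ {x z prefix} → All (¬_ ∘ P) prefix → Chain E x z (prefix ++ z ∷ []) →
         Chain (λ p q → E p q × ¬ P p) x z (prefix ++ z ∷ [])
    go [] end = end
    go (¬Pp ∷ []) (e ◅ c) = (e , ¬Pp) ◅ go [] c
    go (¬Pp ∷ ¬P@(_ ∷ _)) (e ◅ c) = (e , ¬Pp) ◅ go ¬P c

module _ (G : Graph) where
  open Graph G using (n; adj)
  open DecUnique (_≟_ {n}) using (unique?)
  open DecMembership (_≟_ {n}) using (_∈?_)

  private variable
    x y z w p q : Fin n
    xs ys as bs R : List (Fin n)

  Edge-sym : Edge G x y → Edge G y x
  Edge-sym {x} {y} e = trans (Graph.sym G y x) e

  Edge-irrefl : Edge G x y → x ≢ y
  Edge-irrefl {x} e refl with trans (sym e) (Graph.irrefl G x)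
  ... | ()

  Consecutive-∈ : ∀ xs → Consecutive G xs p q → p ∈ xs × q ∈ xs
  Consecutive-∈ (_ ∷ _ ∷ _) (inj₁ (refl , refl)) = here refl , there (here refl)
  Consecutive-∈ (_ ∷ ys@(_ ∷ _)) (inj₂ c) with Consecutive-∈ ys c
  ... | p∈ , q∈ = there p∈ , there q∈

  Consecutive-++ˡ : ∀ xs → Consecutive G xs p q → Consecutive G (xs ++ ys) p q
  Consecutive-++ˡ (_ ∷ _ ∷ _) (inj₁ pq) = inj₁ pq
  Consecutive-++ˡ (_ ∷ xs@(_ ∷ _)) (inj₂ c) = inj₂ (Consecutive-++ˡ xs c)

  Consecutive-++ʳ : ∀ xs → Consecutive G ys p q → Consecutive G (xs ++ ys) p q
  Consecutive-++ʳ [] c = c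
  Consecutive-++ʳ {ys = _ ∷ _ ∷ _} (_ ∷ []) c = inj₂ c
  Consecutive-++ʳ (_ ∷ xs@(_ ∷ _)) c = inj₂ (Consecutive-++ʳ xs c)

  EdgeIn-∈ : ∀ xs → EdgeIn G xs p q → p ∈ xs × q ∈ xs
  EdgeIn-∈ xs (inj₁ c) = Consecutive-∈ xs c
  EdgeIn-∈ xs (inj₂ c) with Consecutive-∈ xs c
  ... | q∈ , p∈ = p∈ , q∈

  EdgeIn-++ˡ : ∀ xs → EdgeIn G xs p q → EdgeIn G (xs ++ ys) p q
  EdgeIn-++ˡ xs (inj₁ c) = inj₁ (Consecutive-++ˡ xs c)
  EdgeIn-++ˡ xs (inj₂ c) = inj₂ (Consecutive-++ˡ xs c)

  EdgeIn-++ʳ : ∀ xs → EdgeIn G ys p q → EdgeIn G (xs ++ ys) p q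
  EdgeIn-++ʳ xs (inj₁ c) = inj₁ (Consecutive-++ʳ xs c)
  EdgeIn-++ʳ xs (inj₂ c) = inj₂ (Consecutive-++ʳ xs c)

  module _ {E : Fin n → Fin n → Set} where

    Chain-Consecutive : Chain E x y xs → Consecutive G xs p q → E p q
    Chain-Consecutive (e ◅ end) (inj₁ (refl , refl)) = e
    Chain-Consecutive (e ◅ _ ◅ _) (inj₁ (refl , refl)) = e
    Chain-Consecutive (_ ◅ c@(_ ◅ _)) (inj₂ pq) = Chain-Consecutive c pq

    Chain-firstEdge : Chain E x y xs → x ≢ y → ∃ λ r → E x r × Consecutive G xs x r
    Chain-firstEdge end x≢y = ⊥-elim (x≢y refl)
    Chain-firstEdge (e ◅ c) _ with Chain-head c
    ... | _ , refl = _ , e , inj₁ (refl , refl)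

    Chain-annotate : Chain E x y xs → Chain (λ p q → E p q × Consecutive G xs p q) x y xs
    Chain-annotate end = end
    Chain-annotate (e ◅ end) = (e , inj₁ (refl , refl)) ◅ end
    Chain-annotate (e ◅ c@(_ ◅ _)) =
      (e , inj₁ (refl , refl)) ◅ Chain-map (λ { (e′ , pq) → e′ , inj₂ pq }) (Chain-annotate c)

  IsPath⇒Chain : IsPath G x y xs → Chain (Edge G) x y xs
  IsPath⇒Chain {xs = x ∷ xs} (refl , ends , walk , _) = go x xs walk ends
    where
    go : ∀ x xs → Walk G (x ∷ xs) → EndsAt G (x ∷ xs) y → Chain (Edge G) x y (x ∷ xs)
    go x [] _ refl = end
    go x (x′ ∷ xs) (e , walk) ends = e ◅ go x′ xs walk ends

  Chain⇒Walk : Chain (Edge G) x y xs → StartsAt G xs x × EndsAt G xs y × Walk G xs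
  Chain⇒Walk end = refl , refl , tt
  Chain⇒Walk (e ◅ c) with Chain⇒Walk c
  Chain⇒Walk (e ◅ end) | _ , ends , walk = refl , ends , e , walk
  Chain⇒Walk (e ◅ _ ◅ _) | _ , ends , walk = refl , ends , e , walk

  Chain⇒IsPath : Chain (Edge G) x y xs → Unique xs → IsPath G x y xs
  Chain⇒IsPath c xs! with Chain⇒Walk c
  ... | starts , ends , walk = starts , ends , walk , xs!

  EndsAt-∈ : ∀ xs → EndsAt G xs y → y ∈ xs
  EndsAt-∈ (_ ∷ []) refl = here refl
  EndsAt-∈ (_ ∷ xs@(_ ∷ _)) ends = there (EndsAt-∈ xs ends)

  IsPath-unique : IsPath G x y xs → Unique xs
  IsPath-unique (_ , _ , _ , xs!) = xs!

  Chain-joinPath : Chain (Edge G) x y (as ++ y ∷ []) → Chain (Edge G) y z R → Chain (Edge G) z w (z ∷ bs) →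
    Unique as → Unique R → Unique bs → Disjoint as R → Disjoint R bs → Disjoint as bs →
    IsPath G x w (as ++ R ++ bs)
  Chain-joinPath {as = as} {R = R} {bs = bs} c₁ c c₂ as! R! bs! as#R R#bs as#bs with Chain-head c
  ... | R′ , refl = Chain⇒IsPath joined (Unique.++⁺ as! (Unique.++⁺ R! bs! R#bs) as#Rbs)
    where
    joined = subst (Chain (Edge G) _ _) (trans (cong (_++ bs) (++-assoc as _ R′)) (++-assoc as R bs))
               (Chain-++ (Chain-++ c₁ c) c₂)
    as#Rbs : Disjoint as (R ++ bs)
    as#Rbs (v∈as , v∈Rbs) with ∈-++⁻ R v∈Rbs
    ... | inj₁ v∈R = as#R (v∈as , v∈R)
    ... | inj₂ v∈bs = as#bs (v∈as , v∈bs)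

  StartsAt? : ∀ xs x → Dec (StartsAt G xs x)
  StartsAt? [] x = no λ ()
  StartsAt? (a ∷ _) x = a ≟ x

  EndsAt? : ∀ xs y → Dec (EndsAt G xs y)
  EndsAt? [] y = no λ ()
  EndsAt? (a ∷ []) y = a ≟ y
  EndsAt? (_ ∷ xs@(_ ∷ _)) y = EndsAt? xs y

  Walk? : ∀ xs → Dec (Walk G xs)
  Walk? [] = yes tt
  Walk? (_ ∷ []) = yes tt
  Walk? (a ∷ xs@(b ∷ _)) = (adj a b Bool.≟ true) ×-dec Walk? xs

  IsPath? : ∀ x y xs → Dec (IsPath G x y xs)
  IsPath? x y xs = StartsAt? xs x ×-dec EndsAt? xs y ×-dec Walk? xs ×-dec unique? xs

  OnSomePath : Fin n → Fin n → Fin n → Set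
  OnSomePath x y v = ∃ λ T → IsPath G x y T × v ∈ T

  OnSomePath? : ∀ x y v → Dec (OnSomePath x y v)
  OnSomePath? x y v = map′ satisfied
    (λ (T , path , v∈T) → lose (∈-listsUpTo n T (Unique⇒length≤n (IsPath-unique path))) (path , v∈T))
    (any? (λ T → IsPath? x y T ×-dec v ∈? T) (listsUpTo n))

module PathsBetween (G : Graph) (pedpp : PEDPP G) (u w : Fin (Graph.n G)) (u≢w : u ≢ w) where
  open Graph G using (n)
  open DecMembership (_≟_ {n}) using (_∈?_)

  private
    V = Fin n
    variable
      a b v z₁ z₂ : V
      as bs cs ds P Q R : List V

  Path : List V → Set
  Path = IsPath G u w

  OnPath : V → Set
  OnPath = OnSomePath G u w

  sharedEdge⇒≡ : Path P → Path Q → EdgeIn G P a b → EdgeIn G Q a b → P ≡ Q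
  sharedEdge⇒≡ {P} {Q} {a} {b} p q ab∈P ab∈Q with ≡-dec _≟_ P Q
  ... | yes P≡Q = P≡Q
  ... | no P≢Q = ⊥-elim (pedpp u w u≢w P Q p q P≢Q a b (ab∈P , ab∈Q))

  -- Shortening the walk along T up to v and then along T′ gives a u–w path whose first edge lies
  -- on T, so it is T; but then the edge of T leaving v lies on T′ as well.
  crossing-impossible : ∀ as bs as′ bs′ → Path (as ++ v ∷ bs) → Path (as′ ++ v ∷ bs′) →
    as ++ v ∷ bs ≢ as′ ++ v ∷ bs′ → v ≢ u → v ≢ w → ⊥
  crossing-impossible as [] _ _ p _ _ _ v≢w with Chain-last∈-suffix as (IsPath⇒Chain G p) v≢w
  ... | ()
  crossing-impossible {v} as (b ∷ bs) as′ bs′ p p′ T≢T′ v≢u v≢w =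
    let _ , shortcut , shortcut! , _ = Chain-shorten _≟_ mixed
    in T-not-mixed (subst (Chain Mixed u w) (shortcut≡T shortcut shortcut!) shortcut)
    where
    T = as ++ v ∷ b ∷ bs
    T≡prefix++bs : (as ++ v ∷ []) ++ b ∷ bs ≡ T
    T≡prefix++bs = ++-assoc as (v ∷ []) (b ∷ bs)

    Mixed : V → V → Set
    Mixed a b = Edge G a b × (EdgeIn G (as ++ v ∷ []) a b ⊎ EdgeIn G (v ∷ bs′) a b)

    mixed : Chain Mixed u w ((as ++ v ∷ []) ++ bs′)
    mixed = Chain-++
      (Chain-map (λ (e , ab) → e , inj₁ (inj₁ ab)) (Chain-annotate G (proj₁ (Chain-split as (IsPath⇒Chain G p)))))
      (Chain-map (λ (e , ab) → e , inj₂ (inj₁ ab)) (Chain-annotate G (proj₂ (Chain-split as′ (IsPath⇒Chain G p′)))))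

    shortcut≡T : ∀ {R} → Chain Mixed u w R → Unique R → R ≡ T
    shortcut≡T shortcut R! with Chain-firstEdge G shortcut u≢w
    ... | r , (_ , inj₁ ur∈prefix) , ur =
      sharedEdge⇒≡ (Chain⇒IsPath G (Chain-map proj₁ shortcut) R!) p (inj₁ ur)
        (subst (λ L → EdgeIn G L u r) T≡prefix++bs (EdgeIn-++ˡ G (as ++ v ∷ []) ur∈prefix))
    ... | r , (_ , inj₂ ur∈suffix′) , _ =
      ⊥-elim (proj₂ (proj₂ (Unique-++⁻ as′ (IsPath-unique G p′)))
        (Chain-head∈-prefix as′ (IsPath⇒Chain G p′) v≢u , proj₁ (EdgeIn-∈ G (v ∷ bs′) ur∈suffix′)))

    T-not-mixed : Chain Mixed u w T → ⊥
    T-not-mixed c with Chain-Consecutive G c (Consecutive-++ʳ G as (inj₁ (refl , refl)))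
    ... | _ , inj₁ vb∈prefix = proj₂ (proj₂ (Unique-++⁻ (as ++ v ∷ []) prefix++bs!))
            (proj₂ (EdgeIn-∈ G (as ++ v ∷ []) vb∈prefix) , here refl)
      where prefix++bs! = subst Unique (sym T≡prefix++bs) (IsPath-unique G p)
    ... | _ , inj₂ vb∈suffix′ = T≢T′ (sharedEdge⇒≡ p p′
            (inj₁ (Consecutive-++ʳ G as (inj₁ (refl , refl)))) (EdgeIn-++ʳ G as′ vb∈suffix′))

  paths-meet-at-ends : ∀ {T T′} → Path T → Path T′ → T ≢ T′ → v ∈ T → v ∈ T′ → v ≡ u ⊎ v ≡ w
  paths-meet-at-ends {v = v} p p′ T≢T′ v∈T v∈T′ with v ≟ u | v ≟ w
  ... | yes v≡u | _ = inj₁ v≡u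
  ... | no _ | yes v≡w = inj₂ v≡w
  ... | no v≢u | no v≢w with ∈-∃++ v∈T | ∈-∃++ v∈T′
  ...   | as , bs , refl | as′ , bs′ , refl =
    ⊥-elim (crossing-impossible as bs as′ bs′ p p′ T≢T′ v≢u v≢w)

  record Bridge (z₁ z₂ : V) (R : List V) : Set where
    field
      chain : Chain (Edge G) z₁ z₂ R
      unique : Unique R
      meets-paths-at-ends : ∀ {c} → c ∈ R → OnPath c → c ≡ z₁ ⊎ c ≡ z₂

  Bridge-reverse : Bridge z₁ z₂ R → Bridge z₂ z₁ (reverse R)
  Bridge-reverse bridge = record
    { chain = Chain-reverse (Edge-sym G) chain
    ; unique = Unique-reverse⁺ unique
    ; meets-paths-at-ends = λ c∈ c-on → swap (meets-paths-at-ends (Any.reverse⁻ c∈) c-on)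
    }
    where open Bridge bridge

  Bridge-disjoint : Bridge z₁ z₂ R → (∀ {c} → c ∈ as → OnPath c) → z₁ ∉ as → z₂ ∉ as → Disjoint as R
  Bridge-disjoint bridge on-path z₁∉as z₂∉as (c∈as , c∈R)
    with Bridge.meets-paths-at-ends bridge c∈R (on-path c∈as)
  ... | inj₁ refl = z₁∉as c∈as
  ... | inj₂ refl = z₂∉as c∈as

  Bridge-join : Path (as ++ z₁ ∷ cs) → Path (ds ++ z₂ ∷ bs) → Bridge z₁ z₂ R →
    z₂ ∉ as → z₁ ∉ bs → Disjoint as bs → Path (as ++ R ++ bs)
  Bridge-join {as} {z₁} {cs} {ds} {z₂} {bs} p₁ p₂ bridge z₂∉as z₁∉bs as#bs =
    Chain-joinPath G (proj₁ (Chain-split as (IsPath⇒Chain G p₁))) (Bridge.chain bridge)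
      (proj₂ (Chain-split ds (IsPath⇒Chain G p₂)))
      as! (Bridge.unique bridge) bs!
      (Bridge-disjoint bridge (λ c∈as → _ , p₁ , ∈-++⁺ˡ c∈as) z₁∉as z₂∉as)
      (λ (c∈R , c∈bs) → Bridge-disjoint bridge (λ c∈bs → _ , p₂ , ∈-++⁺ʳ ds (there c∈bs)) z₁∉bs z₂∉bs
                          (c∈bs , c∈R))
      as#bs
    where
    as! = proj₁ (Unique-++⁻ as (IsPath-unique G p₁))
    z₁∉as = λ z₁∈as → proj₂ (proj₂ (Unique-++⁻ as (IsPath-unique G p₁))) (z₁∈as , here refl)
    z₂∷bs! = proj₁ (proj₂ (Unique-++⁻ ds (IsPath-unique G p₂)))
    bs! = AllPairs.tail z₂∷bs!
    z₂∉bs = Unique.Unique[x∷xs]⇒x∉xs z₂∷bs!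

  ExtendsToPath : List V → Set
  ExtendsToPath R = ∃₂ λ as bs → Path (as ++ R ++ bs) ⊎ Path (as ++ reverse R ++ bs)

  splice-within : Path (as ++ z₁ ∷ cs ++ z₂ ∷ bs) → Bridge z₁ z₂ R → Path (as ++ R ++ bs)
  splice-within {as} {z₁} {cs} {z₂} {bs} p bridge =
    Bridge-join p (subst Path (sym (++-assoc as (z₁ ∷ cs) (z₂ ∷ bs))) p) bridge
      (λ z₂∈as → as#rest (z₂∈as , there (∈-++⁺ʳ cs (here refl))))
      (λ z₁∈bs → Unique.Unique[x∷xs]⇒x∉xs rest! (∈-++⁺ʳ cs (there z₁∈bs)))
      (λ (c∈as , c∈bs) → as#rest (c∈as , there (∈-++⁺ʳ cs (there c∈bs))))
    where
    rest! = proj₁ (proj₂ (Unique-++⁻ as (IsPath-unique G p)))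
    as#rest = proj₂ (proj₂ (Unique-++⁻ as (IsPath-unique G p)))

  splice-across : Path (as ++ z₁ ∷ cs) → Path (ds ++ z₂ ∷ bs) → z₂ ∉ as ++ z₁ ∷ cs → z₁ ∉ ds ++ z₂ ∷ bs →
    Bridge z₁ z₂ R → Path (as ++ R ++ bs)
  splice-across {as} {z₁} {cs} {ds} {z₂} {bs} p₁ p₂ z₂∉T₁ z₁∉T₂ bridge =
    Bridge-join p₁ p₂ bridge (z₂∉T₁ ∘ ∈-++⁺ˡ) (z₁∉T₂ ∘ ∈-++⁺ʳ ds ∘ there) as#bs
    where
    T₁≢T₂ : as ++ z₁ ∷ cs ≢ ds ++ z₂ ∷ bs
    T₁≢T₂ T₁≡T₂ = z₂∉T₁ (subst (z₂ ∈_) (sym T₁≡T₂) (∈-++⁺ʳ ds (here refl)))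
    z₂≢u : z₂ ≢ u
    z₂≢u refl = z₂∉T₁ (Chain-head∈ (IsPath⇒Chain G p₁))
    z₁≢w : z₁ ≢ w
    z₁≢w refl = z₁∉T₂ (Chain-last∈ (IsPath⇒Chain G p₂))
    -- The paths meet only in u and w; u precedes z₂ on the second one and w follows z₁ on the first.
    as#bs : Disjoint as bs
    as#bs (c∈as , c∈bs) with paths-meet-at-ends p₁ p₂ T₁≢T₂ (∈-++⁺ˡ c∈as) (∈-++⁺ʳ ds (there c∈bs))
    ... | inj₁ refl = proj₂ (proj₂ (Unique-++⁻ ds (IsPath-unique G p₂)))
          (Chain-head∈-prefix ds (IsPath⇒Chain G p₂) z₂≢u , there c∈bs)
    ... | inj₂ refl = proj₂ (proj₂ (Unique-++⁻ as (IsPath-unique G p₁)))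
          (c∈as , there (Chain-last∈-suffix as (IsPath⇒Chain G p₁) z₁≢w))

  splice-along : ∀ {T} → Path T → z₁ ∈ T → z₂ ∈ T → z₁ ≢ z₂ → Bridge z₁ z₂ R → ExtendsToPath R
  splice-along {T = T} p z₁∈T z₂∈T z₁≢z₂ bridge with ∈-∈-order T z₁∈T z₂∈T z₁≢z₂
  ... | inj₁ (as , _ , bs , refl) = as , bs , inj₁ (splice-within p bridge)
  ... | inj₂ (as , _ , bs , refl) = as , bs , inj₂ (splice-within p (Bridge-reverse bridge))

  splice : OnPath z₁ → OnPath z₂ → z₁ ≢ z₂ → Bridge z₁ z₂ R → ExtendsToPath R
  splice {z₁} {z₂} (T₁ , p₁ , z₁∈T₁) (T₂ , p₂ , z₂∈T₂) z₁≢z₂ bridge with z₂ ∈? T₁ | z₁ ∈? T₂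
  ... | yes z₂∈T₁ | _ = splice-along p₁ z₁∈T₁ z₂∈T₁ z₁≢z₂ bridge
  ... | no _ | yes z₁∈T₂ = splice-along p₂ z₁∈T₂ z₂∈T₂ z₁≢z₂ bridge
  ... | no z₂∉T₁ | no z₁∉T₂ with ∈-∃++ z₁∈T₁ | ∈-∃++ z₂∈T₂
  ...   | as , _ , refl | _ , bs , refl = as , bs , inj₁ (splice-across p₁ p₂ z₂∉T₁ z₁∉T₂ bridge)

  ExtendsToPath-∈ : ExtendsToPath R → ∀ {c} → c ∈ R → OnPath c
  ExtendsToPath-∈ (as , _ , inj₁ p) c∈R = _ , p , ∈-++⁺ʳ as (∈-++⁺ˡ c∈R)
  ExtendsToPath-∈ (as , _ , inj₂ p) c∈R = _ , p , ∈-++⁺ʳ as (∈-++⁺ˡ (Any.reverse⁺ c∈R))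

  edge-on-path : OnPath a → OnPath b → Edge G a b → ∃ λ T → Path T × EdgeIn G T a b
  edge-on-path {a} {b} a-on b-on e with splice a-on b-on (Edge-irrefl G e) bridge
    where
    bridge : Bridge a b (a ∷ b ∷ [])
    bridge = record
      { chain = e ◅ end
      ; unique = Unique-∷⁺ (λ { (here refl) → Edge-irrefl G e refl }) (Unique-∷⁺ (λ ()) [])
      ; meets-paths-at-ends = λ { (here refl) _ → inj₁ refl ; (there (here refl)) _ → inj₂ refl }
      }
  ... | as , _ , inj₁ p = _ , p , inj₁ (Consecutive-++ʳ G as (inj₁ (refl , refl)))
  ... | as , _ , inj₂ p = _ , p , inj₂ (Consecutive-++ʳ G as (inj₁ (refl , refl)))

  OffPath : V → Set
  OffPath v = ¬ OnPath v

  OffPathEdge : V → V → Set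
  OffPathEdge p q = Edge G p q × (OffPath p ⊎ OffPath q)

  -- A shortest such detour is a bridge, so its first off-path vertex would lie on a u–w path.
  offPath-detour-impossible : ∀ {xs} → OnPath z₁ → OnPath z₂ → z₁ ≢ z₂ → Chain OffPathEdge z₁ z₂ xs →
    (∀ {c} → c ∈ xs → OnPath c → c ≡ z₁ ⊎ c ≡ z₂) → ⊥
  offPath-detour-impossible z₁-on z₂-on z₁≢z₂ detour ends-only with Chain-shorten _≟_ detour
  ... | R , shortcut , R! , R⊆xs with Chain-firstEdge G shortcut z₁≢z₂
  ...   | r , (_ , inj₁ z₁-off) , _ = z₁-off z₁-on
  ...   | r , (_ , inj₂ r-off) , z₁r =
    r-off (ExtendsToPath-∈ (splice z₁-on z₂-on z₁≢z₂ bridge) (proj₂ (Consecutive-∈ G R z₁r)))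
    where
    bridge = record
      { chain = Chain-map proj₁ shortcut
      ; unique = R!
      ; meets-paths-at-ends = λ c∈R → ends-only (R⊆xs c∈R)
      }

module _ {c ℓ ℓ′} {R : CommutativeRing c ℓ} (I : Ideal R ℓ′) where
  open CommutativeRing R using (_≈_; _-_; +-abelianGroup) renaming (sym to ≈-sym)
  open Ideal I
  open import Algebra.Properties.AbelianGroup +-abelianGroup using (x≈y⇒x∙y⁻¹≈ε; ⁻¹-anti-homo‿-)

  x≈y⇒x-y∈I : ∀ {x y} → x ≈ y → (x - y) ∈I
  x≈y⇒x-y∈I x≈y = resp (≈-sym (x≈y⇒x∙y⁻¹≈ε x≈y)) 0∈

  x-y∈I⇒y-x∈I : ∀ {x y} → (x - y) ∈I → (y - x) ∈I
  x-y∈I⇒y-x∈I {x} {y} x-y∈I = resp (⁻¹-anti-homo‿- x y) (neg-closed x-y∈I)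

module TailSums {c ℓ} (R : CommutativeRing c ℓ) (G : Graph) (ℓ′ : Level) (α : EdgeLabeling R G ℓ′) where
  open CommutativeRing R renaming (refl to ≈-refl; sym to ≈-sym; trans to ≈-trans)
  open import Algebra.Properties.AbelianGroup +-abelianGroup using (//-rightDividesʳ)
  open import Relation.Binary.Reasoning.Setoid setoid
  open EdgeLabeling α
  open Graph G using (n)

  private variable
    a b t : Fin n
    y : Carrier

  _∈α[_,_] : Carrier → Fin n → Fin n → Set ℓ′
  r ∈α[ a , b ] = Ideal._∈I (label a b) r

  -- With y = y₁ + ⋯ + yₖ split along the edges of T, the value at the i-th vertex is yᵢ + ⋯ + yₖ.
  tailSum : ∀ T {y} → InPathIdeal R G ℓ′ α T y → Fin n → Carrier
  tailSum [] {y} _ _ = y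
  tailSum (_ ∷ []) {y} _ _ = y
  tailSum (a ∷ b ∷ T) {y} (_ , _ , _ , d , _) v = if does (a ≟ v) then y else tailSum (b ∷ T) d v

  tailSum-head : ∀ a T (d : InPathIdeal R G ℓ′ α (a ∷ T) y) → tailSum (a ∷ T) d a ≡ y
  tailSum-head a [] d = refl
  tailSum-head a (_ ∷ _) d with a ≟ a
  ... | yes _ = refl
  ... | no a≢a = ⊥-elim (a≢a refl)

  tailSum-last : ∀ T (d : InPathIdeal R G ℓ′ α T y) → Unique T → EndsAt G T t → tailSum T d t ≈ 0#
  tailSum-last (_ ∷ []) d _ refl = lower d
  tailSum-last {t = t} (a ∷ b ∷ T) (_ , _ , _ , d , _) (a∉T ∷ T!) ends with a ≟ t
  ... | yes refl = ⊥-elim (All.lookup a∉T (EndsAt-∈ G (b ∷ T) ends) refl)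
  ... | no _ = tailSum-last (b ∷ T) d T! ends

  tailSum-consecutive : ∀ T {y} (d : InPathIdeal R G ℓ′ α T y) → Unique T → Consecutive G T a b →
    (tailSum T d a - tailSum T d b) ∈α[ a , b ]
  tailSum-consecutive (a ∷ b ∷ T) {y} (y₁ , z , y₁∈α , d , y≈y₁+z) (a∉ ∷ _) (inj₁ (refl , refl))
    with a ≟ a | a ≟ b
  ... | no a≢a | _ = ⊥-elim (a≢a refl)
  ... | yes _ | yes a≡b = ⊥-elim (All.lookup a∉ (here refl) a≡b)
  ... | yes _ | no _ = Ideal.resp (label a b) (≈-sym y-z≈y₁) y₁∈α
    where
    y-z≈y₁ : y - tailSum (b ∷ T) d b ≈ y₁
    y-z≈y₁ = begin
      y - tailSum (b ∷ T) d b ≡⟨ cong (λ z′ → y - z′) (tailSum-head b T d) ⟩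
      y - z                   ≈⟨ +-congʳ y≈y₁+z ⟩
      y₁ + z - z              ≈⟨ //-rightDividesʳ z y₁ ⟩
      y₁                      ∎
  tailSum-consecutive {a = a} {b} (v ∷ v′ ∷ T) (_ , _ , _ , d , _) (v∉T ∷ T!) (inj₂ ab∈T)
    with v ≟ a | v ≟ b
  ... | yes v≡a | _ = ⊥-elim (All.lookup v∉T (proj₁ (Consecutive-∈ G (v′ ∷ T) ab∈T)) v≡a)
  ... | no _ | yes v≡b = ⊥-elim (All.lookup v∉T (proj₂ (Consecutive-∈ G (v′ ∷ T) ab∈T)) v≡b)
  ... | no _ | no _ = tailSum-consecutive (v′ ∷ T) d T! ab∈T

  tailSum-edge : ∀ T (d : InPathIdeal R G ℓ′ α T y) → Unique T → EdgeIn G T a b →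
    (tailSum T d a - tailSum T d b) ∈α[ a , b ]
  tailSum-edge T d T! (inj₁ ab∈T) = tailSum-consecutive T d T! ab∈T
  tailSum-edge {a = a} {b} T d T! (inj₂ ba∈T) =
    subst (λ I → Ideal._∈I I (tailSum T d a - tailSum T d b)) (label-sym b a)
      (x-y∈I⇒y-x∈I (label b a) (tailSum-consecutive T d T! ba∈T))

module SplineConstruction (G : Graph) (connected : Connected G) (pedpp : PEDPP G)
  {c ℓ} (ℓ′ : Level) (R : CommutativeRing c ℓ) (α : EdgeLabeling R G ℓ′)
  (u w : Fin (Graph.n G)) (u≢w : u ≢ w) (x : CommutativeRing.Carrier R)
  (x∈α[paths] : ∀ T → IsPath G u w T → InPathIdeal R G ℓ′ α T x) where
  open CommutativeRing R renaming (refl to ≈-refl; sym to ≈-sym; trans to ≈-trans)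
  open import Algebra.Properties.AbelianGroup +-abelianGroup using (//-cong₂; ε⁻¹≈ε)
  open import Relation.Binary.Reasoning.Setoid setoid
  open Graph G using (n)
  open PathsBetween G pedpp u w u≢w
  open TailSums R G ℓ′ α
  open EdgeLabeling α using (label)

  private variable
    a b v : Fin n

  -- IsPath is not propositional, so the decomposition of x is chosen through IsPath? to be
  -- independent of the proof that T is a path.
  decomposition : ∀ T → Path T → InPathIdeal R G ℓ′ α T x
  decomposition T p with IsPath? G u w T
  ... | yes p′ = x∈α[paths] T p′
  ... | no ¬p = ⊥-elim (¬p p)

  decomposition-irrelevant : ∀ T (p q : Path T) → decomposition T p ≡ decomposition T q
  decomposition-irrelevant T p q with IsPath? G u w T
  ... | yes _ = refl
  ... | no ¬p = ⊥-elim (¬p p)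

  value : OnPath v → Carrier
  value {v} (T , p , _) = tailSum T (decomposition T p) v

  value-u : (s : OnPath u) → value s ≈ x
  value-u (a ∷ T , p@(refl , _) , _) = reflexive (tailSum-head a T (decomposition (a ∷ T) p))

  value-w : (s : OnPath w) → value s ≈ 0#
  value-w (T , p@(_ , ends , _ , T!) , _) = tailSum-last T (decomposition T p) T! ends

  value-irrelevant : (s s′ : OnPath v) → value s ≈ value s′
  value-irrelevant {v} s@(T , p , v∈T) s′@(T′ , p′ , v∈T′) with ≡-dec _≟_ T T′
  ... | yes refl = reflexive (cong (λ d → tailSum T d v) (decomposition-irrelevant T p p′))
  ... | no T≢T′ with paths-meet-at-ends p p′ T≢T′ v∈T v∈T′
  ...   | inj₁ refl = ≈-trans (value-u s) (≈-sym (value-u s′))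
  ...   | inj₂ refl = ≈-trans (value-w s) (≈-sym (value-w s′))

  u-onPath : OnPath u
  u-onPath = let (T , p) = connected u w in T , p , Chain-head∈ (IsPath⇒Chain G p)

  w-onPath : OnPath w
  w-onPath = let (T , p) = connected u w in T , p , Chain-last∈ (IsPath⇒Chain G p)

  gate : ∀ v → FirstHit (Edge G) OnPath v
  gate v = Chain-firstHit (OnSomePath? G u w) (IsPath⇒Chain G (proj₂ (connected v w))) w-onPath

  ρ : Fin n → Carrier
  ρ v = value (FirstHit.target-P (gate v))

  ρ-onPath : (s : OnPath v) → ρ v ≈ value s
  ρ-onPath {v} s = go (gate v) (FirstHit-self (gate v) s)
    where
    go : (h : FirstHit (Edge G) OnPath v) → FirstHit.target h ≡ v → value (FirstHit.target-P h) ≈ value s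
    go (firstHit _ t-on _ _) refl = value-irrelevant t-on s

  ρ-edge-onPath : OnPath a → OnPath b → Edge G a b → (ρ a - ρ b) ∈α[ a , b ]
  ρ-edge-onPath {a} {b} a-on b-on e with edge-on-path a-on b-on e
  ... | T , p , ab∈T = Ideal.resp (label a b) (//-cong₂ (≈-sym (ρ-onPath a-on′)) (≈-sym (ρ-onPath b-on′)))
                         (tailSum-edge T (decomposition T p) (IsPath-unique G p) ab∈T)
    where
    a-on′ = T , p , proj₁ (EdgeIn-∈ G T ab∈T)
    b-on′ = T , p , proj₂ (EdgeIn-∈ G T ab∈T)

  ρ-edge-offPath : OffPath a ⊎ OffPath b → Edge G a b → (ρ a - ρ b) ∈α[ a , b ]
  ρ-edge-offPath {a} {b} off e = go (gate a) (gate b)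
    where
    offPathEdge : ∀ {p q} → Edge G p q × ¬ OnPath p → OffPathEdge p q
    offPathEdge (e , p-off) = e , inj₁ p-off
    go : (ha : FirstHit (Edge G) OnPath a) (hb : FirstHit (Edge G) OnPath b) →
         (value (FirstHit.target-P ha) - value (FirstHit.target-P hb)) ∈α[ a , b ]
    go ha@(firstHit za za-on _ _) hb@(firstHit zb zb-on _ _) with za ≟ zb
    ... | yes refl = x≈y⇒x-y∈I (label a b) (value-irrelevant za-on zb-on)
    ... | no za≢zb = ⊥-elim (offPath-detour-impossible za-on zb-on za≢zb detour ends-only)
      where
      detour = Chain-++
        (Chain-reverse (λ (e , off) → Edge-sym G e , swap off) (Chain-map offPathEdge (FirstHit-chain¬P ha)))
        ((e , off) ◅ Chain-map offPathEdge (FirstHit-chain¬P hb))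
      ends-only : ∀ {c} → c ∈ _ → OnPath c → c ≡ za ⊎ c ≡ zb
      ends-only c∈ c-on with ∈-++⁻ _ c∈
      ... | inj₁ c∈ha = inj₁ (FirstHit-unique ha (Any.reverse⁻ c∈ha) c-on)
      ... | inj₂ c∈hb = inj₂ (FirstHit-unique hb c∈hb c-on)

  ρ-spline : IsSpline R G ℓ′ α ρ
  ρ-spline a b e with OnSomePath? G u w a | OnSomePath? G u w b
  ... | yes a-on | yes b-on = ρ-edge-onPath a-on b-on e
  ... | no a-off | _ = ρ-edge-offPath (inj₁ a-off) e
  ... | yes _ | no b-off = ρ-edge-offPath (inj₂ b-off) e

  ρ-difference : ρ u - ρ w ≈ x
  ρ-difference = begin
    ρ u - ρ w ≈⟨ //-cong₂ (≈-trans (ρ-onPath u-onPath) (value-u u-onPath))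
                          (≈-trans (ρ-onPath w-onPath) (value-w w-onPath)) ⟩
    x - 0#    ≈⟨ +-congˡ ε⁻¹≈ε ⟩
    x + 0#    ≈⟨ +-identityʳ x ⟩
    x         ∎

constant-spline : ∀ {c ℓ ℓ′} {R : CommutativeRing c ℓ} {G : Graph} (α : EdgeLabeling R G ℓ′) r →
  IsSpline R G ℓ′ α (λ _ → r)
constant-spline {R = R} α r a b _ = x≈y⇒x-y∈I (EdgeLabeling.label α a b) (CommutativeRing.refl R)

corollary4p7 : (G : Graph) → Connected G → PEDPP G →
    ∀ {c ℓ} (ℓ' : Level) (R : CommutativeRing c ℓ) (α : EdgeLabeling R G ℓ') →
    UniversalDifferenceProperty R G ℓ' α
corollary4p7 G connected pedpp ℓ′ R α u w x x∈α[paths] with u ≟ w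
... | yes refl = (λ _ → 0#) , constant-spline α 0# , ≈-trans (-‿inverseʳ 0#) (≈-sym x≈0)
  where
  open CommutativeRing R using (_≈_; 0#; -‿inverseʳ) renaming (trans to ≈-trans; sym to ≈-sym)
  x≈0 : x ≈ 0#
  x≈0 = lower (x∈α[paths] (u ∷ []) (refl , refl , tt , [] ∷ []))
... | no u≢w = ρ , ρ-spline , ρ-difference
  where open SplineConstruction G connected pedpp ℓ′ R α u w u≢w x x∈α[paths]
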